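{- Let $w$ be an irreducible packed word. Among the factorizations $w=u\triangleleft_B v$ with $u,v$ packed and $v\ne\varepsilon$ there is a unique one maximizing $|u|$. For this factorization, writing $v=\psi_{i^\alpha}(v')$: either $v'=\varepsilon$ and $i^\alpha=1^\circ$, or $v'$ is irreducible and $1\le i\le\max(v')$.
   Context: Words over positive integers; $|w|$ length, $\max(w)$ largest letter ($\max(\varepsilon)=0$), $w^{[k]}$ adds $k$ to every letter. Packed: every integer $1..\max(w)$ occurs. $u\odot v=u^{[\max(v)]}\cdot v$. A global descent of $w$ of length $n$ is $c$, $1\le c\le n-1$, with every letter of $w_1..w_c$ strictly greater than every letter of $w_{c+1}..w_n$; irreducible = nonempty without global descent. For packed $w$: $\psi_{i^\circ}(w)$ ($1\le i\le\max(w)+1$) adds $1$ to every letter $\ge i$ and appends the letter $i$; $\psi_{i^\bullet}(w)=w\cdot i$ ($1\le i\le\max(w)$). Each nonempty packed $v$ is uniquely $\psi_{i^\alpha}(v')$ with $v'$ packed, $i\ge1$, $\alpha\in\{\circ,\bullet\}$ ($\alpha=\bullet$ iff the last letter occurs more than once). For packed $u$ and nonempty packed $v=\psi_{i^\alpha}(v')$, $u\triangleleft_B v=\psi_{(i+\max(u))^\alpha}(v'\odot u)$. -}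

module Defs where

open import Data.Nat using (ℕ; zero; suc; _+_; _≤_; _<_; _⊔_; _≤ᵇ_)
open import Data.Bool using (if_then_else_)
open import Data.List using (List; []; _∷_; _++_; [_]; map; foldr; length; take; drop)
open import Data.List.Relation.Unary.All using (All)
open import Data.List.Membership.Propositional using (_∈_)
open import Data.Product using (Σ; _×_; ∃)
open import Relation.Binary.PropositionalEquality using (_≡_; _≢_)
open import Relation.Nullary using (¬_)

-- Words over positive integers are lists of naturals (positivity is part of IsPacked).
Word : Set
Word = List ℕ

maxW : Word → ℕ
maxW = foldr _⊔_ 0

shift : ℕ → Word → Word
shift k = map (k +_)

IsPacked : Word → Set
IsPacked w = All (λ x → 1 ≤ x) w × (∀ k → 1 ≤ k → k ≤ maxW w → k ∈ w)

_⊙_ : Word → Word → Word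
u ⊙ v = shift (maxW v) u ++ v

IsGlobalDescent : Word → ℕ → Set
IsGlobalDescent w c =
  1 ≤ c × c < length w ×
  (∀ x y → x ∈ take c w → y ∈ drop c w → y < x)

Irreducible : Word → Set
Irreducible w = w ≢ [] × ¬ (∃ λ c → IsGlobalDescent w c)

data Deco : Set where
  ∘ • : Deco

ψ : ℕ → Deco → Word → Word
ψ i ∘ w = map (λ x → if i ≤ᵇ x then suc x else x) w ++ [ i ]
ψ i • w = w ++ [ i ]

ValidIdx : ℕ → Deco → Word → Set
ValidIdx i ∘ w = 1 ≤ i × i ≤ suc (maxW w)
ValidIdx i • w = 1 ≤ i × i ≤ maxW w

-- v = ψ_{i^α}(v') with v' packed and i^α admissible
-- (for nonempty packed v such a decomposition exists and is unique)
IsDecomp : Word → ℕ → Deco → Word → Set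
IsDecomp v i α v' = IsPacked v' × ValidIdx i α v' × v ≡ ψ i α v'

-- u ◁_B v ≡ w, for packed u and nonempty packed v:
-- with v = ψ_{i^α}(v'), w = ψ_{(i + max u)^α}(v' ⊙ u)
TriB : Word → Word → Word → Set
TriB u v w = Σ Word λ v' → Σ ℕ λ i → Σ Deco λ α →
  IsDecomp v i α v' × w ≡ ψ (i + maxW u) α (v' ⊙ u)

IsFactorization : Word → Word → Word → Set
IsFactorization w u v = IsPacked u × IsPacked v × v ≢ [] × TriB u v w

-- Once |u| is fixed, a factorisation w = u ◁_B v is determined by w: the decoration is ∘
-- exactly when the last letter l of w does not occur earlier, undoing ψ_l recovers v′ ⊙ u,
-- and cutting off the last |u| letters recovers u, then v′ and i. So the possible lengths
-- |u| form a decidable bounded set, nonempty because w = ε ◁_B w, and the longest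
-- factorisation exists and is unique.
--
-- For the longest one, a global descent of v′ writes v′ = a ⊙ b with a, b nonempty. If
-- i ≤ max b, the letters coming from a stay above all other letters of w, which gives w a
-- global descent. If i > max b, associativity of ⊙ gives the longer factorisation
-- w = (b ⊙ u) ◁_B ψ_{(i − max b)^α}(a). The same regrouping with a = ε rules out
-- i = max v′ + 1, so i ≤ max v′.
module Submission where

open import Defs
open import Data.Nat using (ℕ; zero; suc; pred; _+_; _∸_; _≤_; _<_; _⊔_; _≤ᵇ_; _<ᵇ_; z≤n; s≤s; _≤?_; _≟_)
open import Data.Nat.Properties
open import Data.Bool using (true; false; if_then_else_)
open import Data.List using ([]; _∷_; _++_; [_]; map; length; take; drop; initLast; _∷ʳ′_)
open import Data.List.Properties
  using (map-id; map-++; map-∘; map-cong; map-id-local; map-injective; length-map; length-++;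
         ++-assoc; ++-identityʳ; ++-conicalʳ; ∷ʳ-injective; take++drop≡id; ≡-dec)
open import Data.List.Relation.Unary.All as All using (All; []; _∷_)
import Data.List.Relation.Unary.All.Properties as All
open import Data.List.Relation.Unary.Any using (here; there)
open import Data.List.Membership.Propositional using (_∈_)
open import Data.List.Membership.Propositional.Properties using (∈-map⁺; ∈-map⁻; ∈-++⁺ˡ; ∈-++⁺ʳ; ∈-++⁻)
open import Data.List.Membership.DecPropositional _≟_ using (_∈?_)
open import Data.Product using (Σ; ∃; _×_; _,_; proj₁; proj₂; map₁; uncurry)
open import Data.Sum using (_⊎_; inj₁; inj₂)
open import Relation.Nullary using (Dec; yes; no; contradiction)
open import Relation.Nullary.Reflects using (ofʸ; ofⁿ)
open import Relation.Nullary.Decidable using (_×-dec_; _⊎-dec_; map′)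
open import Relation.Unary using (Decidable)
open import Relation.Binary.Definitions using (tri<; tri≈; tri>)
open import Relation.Binary.PropositionalEquality using (_≡_; _≢_; refl; sym; trans; cong; cong₂; subst; subst₂; module ≡-Reasoning)

raise : ℕ → ℕ → ℕ
raise i x = if i ≤ᵇ x then suc x else x

lower : ℕ → ℕ → ℕ
lower i x = if i <ᵇ x then pred x else x

raise-≥ : ∀ {i x} → i ≤ x → raise i x ≡ suc x
raise-≥ {i} {x} i≤x with i ≤ᵇ x | ≤ᵇ-reflects-≤ i x
... | true  | _        = refl
... | false | ofⁿ i≰x = contradiction i≤x i≰x

raise-< : ∀ {i x} → x < i → raise i x ≡ x
raise-< {i} {x} x<i with i ≤ᵇ x | ≤ᵇ-reflects-≤ i x
... | true  | ofʸ i≤x = contradiction i≤x (<⇒≱ x<i)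
... | false | _        = refl

lower-> : ∀ {i x} → i < x → lower i x ≡ pred x
lower-> {i} {x} i<x with i <ᵇ x | <ᵇ-reflects-< i x
... | true  | _        = refl
... | false | ofⁿ i≮x = contradiction i<x i≮x

lower-≤ : ∀ {i x} → x ≤ i → lower i x ≡ x
lower-≤ {i} {x} x≤i with i <ᵇ x | <ᵇ-reflects-< i x
... | true  | ofʸ i<x = contradiction x≤i (<⇒≱ i<x)
... | false | _        = refl

raise-pred : ∀ {i x} → i < x → raise i (pred x) ≡ x
raise-pred (s≤s i≤x) = raise-≥ i≤x

x≤raise : ∀ i x → x ≤ raise i x
x≤raise i x with i ≤? x
... | yes i≤x rewrite raise-≥ i≤x = n≤1+n x
... | no  i≰x rewrite raise-< (≰⇒> i≰x) = ≤-refl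

raise≤suc : ∀ i x → raise i x ≤ suc x
raise≤suc i x with i ≤? x
... | yes i≤x rewrite raise-≥ i≤x = ≤-refl
... | no  i≰x rewrite raise-< (≰⇒> i≰x) = n≤1+n x

raise-≢ : ∀ i x → raise i x ≢ i
raise-≢ i x with i ≤? x
... | yes i≤x rewrite raise-≥ i≤x = λ x+1≡i → 1+n≰n (subst (_≤ x) (sym x+1≡i) i≤x)
... | no  i≰x rewrite raise-< (≰⇒> i≰x) = <⇒≢ (≰⇒> i≰x)

raise-mono-< : ∀ i {x y} → x < y → raise i x < raise i y
raise-mono-< i {x} {y} x<y with i ≤? x
... | yes i≤x rewrite raise-≥ i≤x | raise-≥ (≤-trans i≤x (<⇒≤ x<y)) = s≤s x<y
... | no  i≰x rewrite raise-< (≰⇒> i≰x) = <-≤-trans x<y (x≤raise i y)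

raise-mono-≤ : ∀ i {x y} → x ≤ y → raise i x ≤ raise i y
raise-mono-≤ i x≤y with m≤n⇒m<n∨m≡n x≤y
... | inj₁ x<y  = <⇒≤ (raise-mono-< i x<y)
... | inj₂ refl = ≤-refl

lower-raise : ∀ i x → lower i (raise i x) ≡ x
lower-raise i x with i ≤? x
... | yes i≤x rewrite raise-≥ i≤x = lower-> (s≤s i≤x)
... | no  i≰x rewrite raise-< (≰⇒> i≰x) = lower-≤ (<⇒≤ (≰⇒> i≰x))

raise-lower : ∀ {i x} → x ≢ i → raise i (lower i x) ≡ x
raise-lower {i} {x} x≢i with <-cmp i x
... | tri< i<x _ _ rewrite lower-> i<x = raise-pred i<x
... | tri≈ _ i≡x _ = contradiction (sym i≡x) x≢i
... | tri> _ _ x<i rewrite lower-≤ (<⇒≤ x<i) = raise-< x<i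

raise-injective : ∀ i {x y} → raise i x ≡ raise i y → x ≡ y
raise-injective i {x} {y} e = begin
  x                   ≡⟨ sym (lower-raise i x) ⟩
  lower i (raise i x) ≡⟨ cong (lower i) e ⟩
  lower i (raise i y) ≡⟨ lower-raise i y ⟩
  y                   ∎
  where open ≡-Reasoning

relabel : Deco → ℕ → ℕ → ℕ
relabel ∘ i = raise i
relabel • i x = x

unrelabel : Deco → ℕ → ℕ → ℕ
unrelabel ∘ i = lower i
unrelabel • i x = x

unrelabel-relabel : ∀ α i x → unrelabel α i (relabel α i x) ≡ x
unrelabel-relabel ∘ = lower-raise
unrelabel-relabel • i x = refl

x≤relabel : ∀ α i x → x ≤ relabel α i x
x≤relabel ∘ = x≤raise
x≤relabel • i x = ≤-refl

relabel-mono-< : ∀ α i {x y} → x < y → relabel α i x < relabel α i y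
relabel-mono-< ∘ = raise-mono-<
relabel-mono-< • i x<y = x<y

relabel-mono-≤ : ∀ α i {x y} → x ≤ y → relabel α i x ≤ relabel α i y
relabel-mono-≤ ∘ = raise-mono-≤
relabel-mono-≤ • i x≤y = x≤y

ψ-relabel : ∀ i α x → ψ i α x ≡ map (relabel α i) x ++ [ i ]
ψ-relabel i ∘ x = refl
ψ-relabel i • x = cong (_++ [ i ]) (sym (map-id x))

∷ʳ-≢[] : ∀ (xs : Word) x → xs ++ [ x ] ≢ []
∷ʳ-≢[] xs x e with ++-conicalʳ xs [ x ] e
... | ()

ψ-≢[] : ∀ i α x → ψ i α x ≢ []
ψ-≢[] i α x e = ∷ʳ-≢[] (map (relabel α i) x) i (trans (sym (ψ-relabel i α x)) e)

length-ψ : ∀ i α x → length (ψ i α x) ≡ suc (length x)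
length-ψ i α x = begin
  length (ψ i α x)                         ≡⟨ cong length (ψ-relabel i α x) ⟩
  length (map (relabel α i) x ++ [ i ])    ≡⟨ length-++ (map (relabel α i) x) ⟩
  length (map (relabel α i) x) + 1         ≡⟨ cong (_+ 1) (length-map (relabel α i) x) ⟩
  length x + 1                             ≡⟨ +-comm (length x) 1 ⟩
  suc (length x)                           ∎
  where open ≡-Reasoning

ψ-injective : ∀ {i α x j y} → ψ i α x ≡ ψ j α y → i ≡ j × x ≡ y
ψ-injective {i} {∘} {x} {j} {y} e with ∷ʳ-injective (map (raise i) x) (map (raise j) y) e
... | raised≡ , refl = refl , map-injective (raise-injective i) raised≡
ψ-injective {α = •} {x} {y = y} e with ∷ʳ-injective x y e
... | x≡y , i≡j = i≡j , x≡y

ψ∘≢ψ• : ∀ {i x j y} → j ∈ y → ψ i ∘ x ≢ ψ j • y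
ψ∘≢ψ• {i} {x} {j} {y} j∈y e with ∷ʳ-injective (map (raise i) x) y e
... | refl , refl with ∈-map⁻ (raise i) j∈y
...   | z , _ , i≡raise = raise-≢ i z (sym i≡raise)

splitLast : Word → Word × ℕ
splitLast []           = [] , 0
splitLast (x ∷ [])     = [] , x
splitLast (x ∷ y ∷ ys) = map₁ (x ∷_) (splitLast (y ∷ ys))

splitLast-∷ʳ : ∀ y l → splitLast (y ++ [ l ]) ≡ (y , l)
splitLast-∷ʳ []           l = refl
splitLast-∷ʳ (x ∷ [])     l = refl
splitLast-∷ʳ (x ∷ z ∷ zs) l = cong (map₁ (x ∷_)) (splitLast-∷ʳ (z ∷ zs) l)

unψ : Deco → Word → Word × ℕ
unψ α w = map (unrelabel α (proj₂ (splitLast w))) (proj₁ (splitLast w)) , proj₂ (splitLast w)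

unψ-ψ : ∀ α l x → unψ α (ψ l α x) ≡ (x , l)
unψ-ψ α l x rewrite ψ-relabel l α x | splitLast-∷ʳ (map (relabel α l) x) l =
  cong (_, l) (trans (sym (map-∘ x)) (trans (map-cong (unrelabel-relabel α l) x) (map-id x)))

∈⇒≤maxW : ∀ {x xs} → x ∈ xs → x ≤ maxW xs
∈⇒≤maxW {xs = y ∷ ys} (here refl) = m≤m⊔n y (maxW ys)
∈⇒≤maxW {xs = y ∷ ys} (there x∈) = ≤-trans (∈⇒≤maxW x∈) (m≤n⊔m y (maxW ys))

maxW-∈ : ∀ {xs} → xs ≢ [] → maxW xs ∈ xs
maxW-∈ {[]} xs≢[] = contradiction refl xs≢[]
maxW-∈ {x ∷ []} _ = here (⊔-identityʳ x)
maxW-∈ {x ∷ y ∷ ys} _ with ⊔-sel x (maxW (y ∷ ys)) | maxW-∈ {y ∷ ys} (λ ())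
... | inj₁ max≡x | _       = here max≡x
... | inj₂ max≡  | max∈ys = there (subst (_∈ y ∷ ys) (sym max≡) max∈ys)

maxW-++ : ∀ xs ys → maxW (xs ++ ys) ≡ maxW xs ⊔ maxW ys
maxW-++ []       ys = refl
maxW-++ (x ∷ xs) ys = trans (cong (x ⊔_) (maxW-++ xs ys)) (sym (⊔-assoc x (maxW xs) (maxW ys)))

maxW-shift-⊔ : ∀ m xs → maxW (shift m xs) ⊔ m ≡ m + maxW xs
maxW-shift-⊔ m []       = sym (+-identityʳ m)
maxW-shift-⊔ m (x ∷ xs) = begin
  (m + x) ⊔ maxW (shift m xs) ⊔ m    ≡⟨ ⊔-assoc (m + x) (maxW (shift m xs)) m ⟩
  (m + x) ⊔ (maxW (shift m xs) ⊔ m)  ≡⟨ cong ((m + x) ⊔_) (maxW-shift-⊔ m xs) ⟩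
  (m + x) ⊔ (m + maxW xs)            ≡⟨ sym (+-distribˡ-⊔ m x (maxW xs)) ⟩
  m + (x ⊔ maxW xs)                  ∎
  where open ≡-Reasoning

maxW-⊙ : ∀ x y → maxW (x ⊙ y) ≡ maxW y + maxW x
maxW-⊙ x y = trans (maxW-++ (shift (maxW y) x) y) (maxW-shift-⊔ (maxW y) x)

length-⊙ : ∀ x y → length (x ⊙ y) ≡ length x + length y
length-⊙ x y = trans (length-++ (shift (maxW y) x)) (cong (_+ length y) (length-map (maxW y +_) x))

⊙-longer : ∀ {x} y → x ≢ [] → length y < length (x ⊙ y)
⊙-longer {[]}     y x≢[] = contradiction refl x≢[]
⊙-longer {_ ∷ xs} y _    = s≤s (≤-trans (m≤n+m (length y) (length xs)) (≤-reflexive (sym (length-⊙ xs y))))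

⊙-identityʳ : ∀ x → x ⊙ [] ≡ x
⊙-identityʳ x = trans (++-identityʳ (map (0 +_) x)) (map-id x)

shift-shift : ∀ m n xs → shift m (shift n xs) ≡ shift (m + n) xs
shift-shift m n xs = trans (sym (map-∘ xs)) (map-cong (λ x → sym (+-assoc m n x)) xs)

⊙-assoc : ∀ x y z → (x ⊙ y) ⊙ z ≡ x ⊙ (y ⊙ z)
⊙-assoc x y z = begin
  shift mz (shift my x ++ y) ++ z            ≡⟨ cong (_++ z) (map-++ (mz +_) (shift my x) y) ⟩
  (shift mz (shift my x) ++ shift mz y) ++ z ≡⟨ ++-assoc (shift mz (shift my x)) (shift mz y) z ⟩
  shift mz (shift my x) ++ (y ⊙ z)           ≡⟨ cong (_++ (y ⊙ z)) (shift-shift mz my x) ⟩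
  shift (mz + my) x ++ (y ⊙ z)               ≡⟨ cong (λ m → shift m x ++ (y ⊙ z)) (sym (maxW-⊙ y z)) ⟩
  x ⊙ (y ⊙ z)                                ∎
  where
  open ≡-Reasoning
  my = maxW y
  mz = maxW z

descent-⊙ : ∀ {a b} → All (maxW b <_) a → a ++ b ≡ map (_∸ maxW b) a ⊙ b
descent-⊙ {a} {b} above = cong (_++ b) (sym (trans (sym (map-∘ a))
  (map-id-local (All.map (λ mb<x → m+[n∸m]≡n (<⇒≤ mb<x)) above))))

DownClosed : Word → Set
DownClosed w = ∀ {k z} → 1 ≤ k → k ≤ z → z ∈ w → k ∈ w

packed⇒downClosed : ∀ {w} → IsPacked w → DownClosed w
packed⇒downClosed (_ , cover) 1≤k k≤z z∈w = cover _ 1≤k (≤-trans k≤z (∈⇒≤maxW z∈w))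

packed-intro : ∀ {w} → All (1 ≤_) w → DownClosed w → IsPacked w
packed-intro {w} positive down = positive , cover
  where
  cover : ∀ k → 1 ≤ k → k ≤ maxW w → k ∈ w
  cover k 1≤k k≤max = down 1≤k k≤max (maxW-∈ λ w≡[] → <⇒≱ 1≤k (subst (λ w → k ≤ maxW w) w≡[] k≤max))

packed-[] : IsPacked []
packed-[] = [] , λ k 1≤k k≤0 → contradiction k≤0 (<⇒≱ 1≤k)

valid•⇒∈ : ∀ {i x} → IsPacked x → ValidIdx i • x → i ∈ x
valid•⇒∈ (_ , cover) (1≤i , i≤max) = cover _ 1≤i i≤max

packed-⊙ : ∀ {x y} → IsPacked x → IsPacked y → IsPacked (x ⊙ y)
packed-⊙ {x} {y} px@(xpos , _) (ypos , ycover) =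
  packed-intro (All.++⁺ (All.map⁺ (All.map (λ {a} 1≤a → ≤-trans 1≤a (m≤n+m a m)) xpos)) ypos) down
  where
  m = maxW y
  down : DownClosed (x ⊙ y)
  down {k} {z} 1≤k k≤z z∈ with k ≤? m
  ... | yes k≤m = ∈-++⁺ʳ (shift m x) (ycover k 1≤k k≤m)
  ... | no  k≰m with ∈-++⁻ (shift m x) z∈
  ...   | inj₂ z∈y = contradiction (≤-trans k≤z (∈⇒≤maxW z∈y)) k≰m
  ...   | inj₁ z∈shifted with ∈-map⁻ (m +_) z∈shifted
  ...     | z₀ , z₀∈x , refl =
    subst (_∈ x ⊙ y) (m+[n∸m]≡n (<⇒≤ (≰⇒> k≰m)))
      (∈-++⁺ˡ (∈-map⁺ (m +_) (packed⇒downClosed px (m<n⇒0<n∸m (≰⇒> k≰m)) (m≤n+o⇒m∸n≤o k m k≤z) z₀∈x)))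

-- The positivity hypothesis is needed: [ 0 ] ⊙ [ 1 ] is packed, [ 0 ] is not.
packed-⊙⁻ : ∀ {x y} → All (1 ≤_) x → IsPacked (x ⊙ y) → IsPacked x × IsPacked y
packed-⊙⁻ {x} {y} xpos pxy@(xypos , _) =
  packed-intro xpos downx , packed-intro (All.++⁻ʳ (shift m x) xypos) downy
  where
  m = maxW y
  down = packed⇒downClosed pxy
  downy : DownClosed y
  downy 1≤k k≤z z∈y with ∈-++⁻ (shift m x) (down 1≤k k≤z (∈-++⁺ʳ (shift m x) z∈y))
  ... | inj₂ k∈y = k∈y
  ... | inj₁ k∈shifted with ∈-map⁻ (m +_) k∈shifted
  ...   | k₀ , k₀∈x , refl = contradiction (≤-trans k≤z (∈⇒≤maxW z∈y)) (<⇒≱ (m<m+n m (All.lookup xpos k₀∈x)))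
  downx : DownClosed x
  downx {k} 1≤k k≤z z∈x
    with ∈-++⁻ (shift m x) (down (≤-trans 1≤k (m≤n+m k m)) (+-monoʳ-≤ m k≤z) (∈-++⁺ˡ (∈-map⁺ (m +_) z∈x)))
  ... | inj₂ m+k∈y = contradiction (∈⇒≤maxW m+k∈y) (<⇒≱ (m<m+n m 1≤k))
  ... | inj₁ m+k∈shifted with ∈-map⁻ (m +_) m+k∈shifted
  ...   | k₀ , k₀∈x , m+k≡m+k₀ = subst (_∈ x) (sym (+-cancelˡ-≡ m k k₀ m+k≡m+k₀)) k₀∈x

packed-ψ : ∀ {x i α} → IsPacked x → ValidIdx i α x → IsPacked (ψ i α x)
packed-ψ {x} {i} {•} px@(xpos , xcover) (1≤i , i≤max) = packed-intro (All.++⁺ xpos (1≤i ∷ [])) down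
  where
  ≤max : ∀ {z} → z ∈ x ++ [ i ] → z ≤ maxW x
  ≤max z∈ with ∈-++⁻ x z∈
  ... | inj₁ z∈x = ∈⇒≤maxW z∈x
  ... | inj₂ (here refl) = i≤max
  down : DownClosed (x ++ [ i ])
  down 1≤k k≤z z∈ = ∈-++⁺ˡ (xcover _ 1≤k (≤-trans k≤z (≤max z∈)))
packed-ψ {x} {i} {∘} (xpos , xcover) (1≤i , i≤1+max) =
  packed-intro (All.++⁺ (All.map⁺ (All.map (λ {a} 1≤a → ≤-trans 1≤a (x≤raise i a)) xpos)) (1≤i ∷ [])) down
  where
  raised = map (raise i) x
  pred≤max : ∀ {k z} → i < k → k ≤ z → z ∈ raised ++ [ i ] → pred k ≤ maxW x
  pred≤max i<k k≤z z∈ with ∈-++⁻ raised z∈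
  ... | inj₂ (here refl) = contradiction k≤z (<⇒≱ i<k)
  ... | inj₁ z∈raised with ∈-map⁻ (raise i) z∈raised
  ...   | z₀ , z₀∈x , refl = ≤-trans (pred-mono-≤ (≤-trans k≤z (raise≤suc i z₀))) (∈⇒≤maxW z₀∈x)
  down : DownClosed (raised ++ [ i ])
  down {k} 1≤k k≤z z∈ with <-cmp k i
  ... | tri≈ _ refl _ = ∈-++⁺ʳ raised (here refl)
  ... | tri< k<i _ _ =
    ∈-++⁺ˡ (subst (_∈ raised) (raise-< k<i) (∈-map⁺ (raise i) (xcover k 1≤k (≤-pred (≤-trans k<i i≤1+max)))))
  ... | tri> _ _ i<k =
    ∈-++⁺ˡ (subst (_∈ raised) (raise-pred i<k)
      (∈-map⁺ (raise i) (xcover (pred k) (≤-trans 1≤i (pred-mono-≤ i<k)) (pred≤max i<k k≤z z∈))))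

-- i ∸ 1 occurs in ψ i ∘ x below i, so it is an unraised letter of x.
ψ∘-index-bound : ∀ {i x} → IsPacked (ψ i ∘ x) → i ≤ suc (maxW x)
ψ∘-index-bound {zero}        _  = z≤n
ψ∘-index-bound {suc zero}    _  = s≤s z≤n
ψ∘-index-bound {suc (suc j)} {x} pw
  with ∈-++⁻ (map (raise (suc (suc j))) x) (packed⇒downClosed pw (s≤s z≤n) (n≤1+n (suc j)) (∈-++⁺ʳ _ (here refl)))
... | inj₂ (here 1+j≡2+j) = contradiction 1+j≡2+j (<⇒≢ ≤-refl)
... | inj₁ 1+j∈raised with ∈-map⁻ (raise (suc (suc j))) 1+j∈raised
...   | z , z∈x , 1+j≡raise = s≤s (subst (_≤ maxW x) z≡1+j (∈⇒≤maxW z∈x))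
  where
  z≡1+j : z ≡ suc j
  z≡1+j = trans (sym (lower-raise (suc (suc j)) z)) (trans (cong (lower (suc (suc j))) (sym 1+j≡raise)) (lower-≤ (n≤1+n (suc j))))

packed-ψ∘⁻ : ∀ {i x} → IsPacked (ψ i ∘ x) → IsPacked x × ValidIdx i ∘ x
packed-ψ∘⁻ {i} {x} pw@(wpos , _) = packed-intro xpos down , 1≤i , ψ∘-index-bound pw
  where
  1≤i : 1 ≤ i
  1≤i = All.lookup wpos (∈-++⁺ʳ _ (here refl))
  positive : ∀ z → 1 ≤ raise i z → 1 ≤ z
  positive zero    1≤raise = contradiction (subst (1 ≤_) (raise-< 1≤i) 1≤raise) λ ()
  positive (suc z) _       = s≤s z≤n
  xpos : All (1 ≤_) x
  xpos = All.tabulate λ {z} z∈x → positive z (All.lookup wpos (∈-++⁺ˡ (∈-map⁺ (raise i) z∈x)))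
  down : DownClosed x
  down {k} 1≤k k≤z z∈x
    with ∈-++⁻ (map (raise i) x)
           (packed⇒downClosed pw (≤-trans 1≤k (x≤raise i k)) (raise-mono-≤ i k≤z) (∈-++⁺ˡ (∈-map⁺ (raise i) z∈x)))
  ... | inj₂ (here raise≡i) = contradiction raise≡i (raise-≢ i k)
  ... | inj₁ raise∈ with ∈-map⁻ (raise i) raise∈
  ...   | k₀ , k₀∈x , raise≡ = subst (_∈ x) (raise-injective i (sym raise≡)) k₀∈x

packed-ψ•⁻ : ∀ {i x} → IsPacked (ψ i • x) → i ∈ x → IsPacked x × ValidIdx i • x
packed-ψ•⁻ {i} {x} pw@(wpos , _) i∈x =
  packed-intro (All.++⁻ˡ x wpos) down , All.lookup wpos (∈-++⁺ʳ x (here refl)) , ∈⇒≤maxW i∈x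
  where
  down : DownClosed x
  down 1≤k k≤z z∈x with ∈-++⁻ x (packed⇒downClosed pw 1≤k k≤z (∈-++⁺ˡ z∈x))
  ... | inj₁ k∈x = k∈x
  ... | inj₂ (here refl) = i∈x

Decomposition : Word → Set
Decomposition v = Σ Word λ v′ → Σ ℕ λ i → Σ Deco λ α → IsDecomp v i α v′

decomposition : ∀ {v} → IsPacked v → v ≢ [] → Decomposition v
decomposition {v} pv v≢[] with initLast v
... | [] = contradiction refl v≢[]
... | y ∷ʳ′ l with l ∈? y
...   | yes l∈y = y , l , • , proj₁ (packed-ψ•⁻ pv l∈y) , proj₂ (packed-ψ•⁻ pv l∈y) , refl
...   | no  l∉y = x , l , ∘ , proj₁ (packed-ψ∘⁻ pw) , proj₂ (packed-ψ∘⁻ pw) , cong (_++ [ l ]) y≡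
  where
  x = map (lower l) y
  y≡ : y ≡ map (raise l) x
  y≡ = sym (trans (sym (map-∘ y)) (map-id-local (All.tabulate λ z∈y → raise-lower λ z≡l → l∉y (subst (_∈ y) z≡l z∈y))))
  pw : IsPacked (ψ l ∘ x)
  pw = subst (λ y → IsPacked (y ++ [ l ])) y≡ pv

decomposition-unique : ∀ {v i α x j β y} → IsDecomp v i α x → IsDecomp v j β y → α ≡ β × i ≡ j × x ≡ y
decomposition-unique {α = ∘} {β = ∘} (_ , _ , e) (_ , _ , e′) = refl , ψ-injective {α = ∘} (trans (sym e) e′)
decomposition-unique {α = •} {β = •} (_ , _ , e) (_ , _ , e′) = refl , ψ-injective {α = •} (trans (sym e) e′)
decomposition-unique {α = ∘} {β = •} (_ , _ , e) (py , valy , e′) =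
  contradiction (trans (sym e) e′) (ψ∘≢ψ• (valid•⇒∈ py valy))
decomposition-unique {α = •} {β = ∘} (px , valx , e) (_ , _ , e′) =
  contradiction (trans (sym e′) e) (ψ∘≢ψ• (valid•⇒∈ px valx))

validIdx-∸ : ∀ α {x b i} → maxW b < i → ValidIdx i α (x ⊙ b) → ValidIdx (i ∸ maxW b) α x
validIdx-∸ ∘ {x} {b} {i} mb<i (_ , i≤) =
  m<n⇒0<n∸m mb<i , m≤n+o⇒m∸n≤o i (maxW b) (≤-trans i≤ (≤-reflexive (trans (cong suc (maxW-⊙ x b)) (sym (+-suc (maxW b) (maxW x))))))
validIdx-∸ • {x} {b} {i} mb<i (_ , i≤) =
  m<n⇒0<n∸m mb<i , m≤n+o⇒m∸n≤o i (maxW b) (≤-trans i≤ (≤-reflexive (maxW-⊙ x b)))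

length-positive : ∀ {xs : Word} → xs ≢ [] → 1 ≤ length xs
length-positive {[]}    xs≢[] = contradiction refl xs≢[]
length-positive {_ ∷ _} _     = s≤s z≤n

map-≢[] : ∀ {f : ℕ → ℕ} {xs} → xs ≢ [] → map f xs ≢ []
map-≢[] {xs = []}    xs≢[] = contradiction refl xs≢[]
map-≢[] {xs = _ ∷ _} _ ()

take-≢[] : ∀ {c} {xs : Word} → 1 ≤ c → c < length xs → take c xs ≢ []
take-≢[] {suc c} {_ ∷ _} _ _ ()

drop-≢[] : ∀ {c} {xs : Word} → c < length xs → drop c xs ≢ []
drop-≢[] {zero}  {_ ∷ _}  _         ()
drop-≢[] {suc c} {_ ∷ xs} (s≤s c<n) = drop-≢[] {c} {xs} c<n

take-length-++ : ∀ (xs ys : Word) → take (length xs) (xs ++ ys) ≡ xs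
take-length-++ []       ys = refl
take-length-++ (x ∷ xs) ys = cong (x ∷_) (take-length-++ xs ys)

drop-length-++ : ∀ (xs ys : Word) → drop (length xs) (xs ++ ys) ≡ ys
drop-length-++ []       ys = refl
drop-length-++ (x ∷ xs) ys = drop-length-++ xs ys

++-globalDescent : ∀ {P Q t} → P ≢ [] → Q ≢ [] → All (t <_) P → All (_≤ t) Q → IsGlobalDescent (P ++ Q) (length P)
++-globalDescent {P} {Q} P≢[] Q≢[] highs lows =
  length-positive P≢[] ,
  subst (length P <_) (sym (length-++ P)) (m<m+n (length P) (length-positive Q≢[])) ,
  λ x y x∈ y∈ → ≤-<-trans (All.lookup lows (subst (y ∈_) (drop-length-++ P Q) y∈))
                           (All.lookup highs (subst (x ∈_) (take-length-++ P Q) x∈))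

ψ-globalDescent : ∀ {A Z T l} α → A ≢ [] → All (T <_) A → All (_≤ T) Z → l ≤ T →
  IsGlobalDescent (ψ l α (A ++ Z)) (length A)
ψ-globalDescent {A} {Z} {T} {l} α A≢[] highs lows l≤T =
  subst₂ IsGlobalDescent (sym ψ≡) (length-map f A)
    (++-globalDescent (map-≢[] A≢[]) (∷ʳ-≢[] (map f Z) l)
      (All.map⁺ (All.map (relabel-mono-< α l) highs))
      (All.++⁺ (All.map⁺ (All.map (relabel-mono-≤ α l) lows)) (≤-trans l≤T (x≤relabel α l T) ∷ [])))
  where
  f = relabel α l
  ψ≡ : ψ l α (A ++ Z) ≡ map f A ++ (map f Z ++ [ l ])
  ψ≡ = trans (ψ-relabel l α (A ++ Z)) (trans (cong (_++ [ l ]) (map-++ f A Z)) (++-assoc (map f A) (map f Z) [ l ]))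

Splitting : Word → Word → Word → ℕ → Deco → Set
Splitting w u v′ i α = IsPacked u × IsPacked v′ × ValidIdx i α v′ × w ≡ ψ (i + maxW u) α (v′ ⊙ u)

splitting⇒factorization : ∀ {w u v′ i α} → Splitting w u v′ i α → IsFactorization w u (ψ i α v′)
splitting⇒factorization {v′ = v′} {i} {α} (pu , pv′ , valid , e) =
  pu , packed-ψ pv′ valid , ψ-≢[] i α v′ , v′ , i , α , (pv′ , valid , refl) , e

factorization⇒splitting : ∀ {w u v} → IsFactorization w u v →
  Σ Word λ v′ → Σ ℕ λ i → Σ Deco λ α → Splitting w u v′ i α × v ≡ ψ i α v′
factorization⇒splitting (pu , _ , _ , v′ , i , α , (pv′ , valid , v≡) , e) = v′ , i , α , (pu , pv′ , valid , e) , v≡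

trivial-splitting : ∀ {w i α v′} → IsDecomp w i α v′ → Splitting w [] v′ i α
trivial-splitting {i = i} {α} {v′} (pv′ , valid , e) =
  packed-[] , pv′ , valid , trans e (cong₂ (λ j x → ψ j α x) (sym (+-identityʳ i)) (sym (⊙-identityʳ v′)))

splitting-length : ∀ {w u v′ i α} → Splitting w u v′ i α → length u ≤ length w
splitting-length {u = u} {v′} {i} {α} (_ , _ , _ , refl) = begin
  length u                                   ≤⟨ m≤n+m (length u) (length v′) ⟩
  length v′ + length u                       ≡⟨ sym (length-⊙ v′ u) ⟩
  length (v′ ⊙ u)                            ≤⟨ n≤1+n _ ⟩
  suc (length (v′ ⊙ u))                      ≡⟨ sym (length-ψ (i + maxW u) α (v′ ⊙ u)) ⟩
  length (ψ (i + maxW u) α (v′ ⊙ u))         ∎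
  where open ≤-Reasoning

regroup : ∀ {w u a b i α} → Splitting w u (a ++ b) i α → All (maxW b <_) a → maxW b < i →
  Splitting w (b ⊙ u) (map (_∸ maxW b) a) (i ∸ maxW b) α
regroup {w} {u} {a} {b} {i} {α} (pu , pab , valid , e) above mb<i =
  packed-⊙ pb pu , pa₀ , validIdx-∸ α mb<i (subst (ValidIdx i α) ab≡ valid) , w≡
  where
  mb = maxW b
  mu = maxW u
  a₀ = map (_∸ mb) a
  ab≡ : a ++ b ≡ a₀ ⊙ b
  ab≡ = descent-⊙ above
  pa₀×pb = packed-⊙⁻ (All.map⁺ (All.map m<n⇒0<n∸m above)) (subst IsPacked ab≡ pab)
  pa₀ = proj₁ pa₀×pb
  pb = proj₂ pa₀×pb
  index≡ : i + mu ≡ (i ∸ mb) + maxW (b ⊙ u)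
  index≡ = begin
    i + mu              ≡⟨ cong (_+ mu) (sym (m∸n+n≡m (<⇒≤ mb<i))) ⟩
    (i ∸ mb + mb) + mu  ≡⟨ +-assoc (i ∸ mb) mb mu ⟩
    i ∸ mb + (mb + mu)  ≡⟨ cong (i ∸ mb +_) (trans (+-comm mb mu) (sym (maxW-⊙ b u))) ⟩
    i ∸ mb + maxW (b ⊙ u) ∎
    where open ≡-Reasoning
  w≡ : w ≡ ψ ((i ∸ mb) + maxW (b ⊙ u)) α (a₀ ⊙ (b ⊙ u))
  w≡ = trans e (cong₂ (λ l X → ψ l α X) index≡ (trans (cong (_⊙ u) ab≡) (⊙-assoc a₀ b u)))

splitting-globalDescent : ∀ {w u a b i α} → Splitting w u (a ++ b) i α →
  a ≢ [] → All (maxW b <_) a → i ≤ maxW b → ∃ (IsGlobalDescent w)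
splitting-globalDescent {w} {u} {a} {b} {i} {α} (_ , _ , _ , e) a≢[] above i≤mb =
  length (shift mu a) ,
  subst (λ w → IsGlobalDescent w (length (shift mu a))) (sym w≡) (ψ-globalDescent α (map-≢[] a≢[]) highs lows l≤T)
  where
  mu = maxW u
  T = mu + maxW b
  w≡ : w ≡ ψ (i + mu) α (shift mu a ++ (shift mu b ++ u))
  w≡ = trans e (cong (ψ (i + mu) α) (trans (cong (_++ u) (map-++ (mu +_) a b)) (++-assoc (shift mu a) (shift mu b) u)))
  highs : All (T <_) (shift mu a)
  highs = All.map⁺ (All.map (+-monoʳ-< mu) above)
  lows : All (_≤ T) (shift mu b ++ u)
  lows = All.++⁺ {xs = shift mu b} (All.map⁺ (All.tabulate λ y∈b → +-monoʳ-≤ mu (∈⇒≤maxW y∈b)))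
                 (All.tabulate λ z∈u → ≤-trans (∈⇒≤maxW z∈u) (m≤m+n mu (maxW b)))
  l≤T : i + mu ≤ T
  l≤T = ≤-trans (+-monoˡ-≤ mu i≤mb) (≤-reflexive (+-comm (maxW b) mu))

length-++-∸ˡ : ∀ (xs ys : Word) → length (xs ++ ys) ∸ length ys ≡ length xs
length-++-∸ˡ xs ys = trans (cong (_∸ length ys) (length-++ xs)) (m+n∸n≡m (length xs) (length ys))

unsuffix : ℕ → Word → ℕ → Word × Word × ℕ
unsuffix k X l = let u = drop (length X ∸ k) X in u , map (_∸ maxW u) (take (length X ∸ k) X) , l ∸ maxW u

unsuffix-⊙ : ∀ u v′ i → unsuffix (length u) (v′ ⊙ u) (i + maxW u) ≡ (u , v′ , i)
unsuffix-⊙ u v′ i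
  rewrite length-++-∸ˡ (shift (maxW u) v′) u | drop-length-++ (shift (maxW u) v′) u | take-length-++ (shift (maxW u) v′) u =
  cong₂ (λ x j → u , x , j)
    (trans (sym (map-∘ v′)) (trans (map-cong (m+n∸m≡n (maxW u)) v′) (map-id v′)))
    (m+n∸n≡m i (maxW u))

unfactor : Deco → ℕ → Word → Word × Word × ℕ
unfactor α k w = uncurry (unsuffix k) (unψ α w)

unfactor-splitting : ∀ {w} u v′ i α → w ≡ ψ (i + maxW u) α (v′ ⊙ u) → unfactor α (length u) w ≡ (u , v′ , i)
unfactor-splitting u v′ i α refl =
  trans (cong (uncurry (unsuffix (length u))) (unψ-ψ α (i + maxW u) (v′ ⊙ u))) (unsuffix-⊙ u v′ i)

index∈ : ∀ {w u v′ i} → Splitting w u v′ i • → i + maxW u ∈ v′ ⊙ u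
index∈ {u = u} {v′} {i} (_ , pv′ , valid , _) =
  ∈-++⁺ˡ (subst (_∈ shift (maxW u) v′) (+-comm (maxW u) i) (∈-map⁺ (maxW u +_) (valid•⇒∈ pv′ valid)))

splitting-deco-unique : ∀ {w u v′ i α u₂ v₂ j β} → Splitting w u v′ i α → Splitting w u₂ v₂ j β → α ≡ β
splitting-deco-unique {α = ∘} {β = ∘} _ _ = refl
splitting-deco-unique {α = •} {β = •} _ _ = refl
splitting-deco-unique {α = ∘} {β = •} s@(_ , _ , _ , e) s₂@(_ , _ , _ , e₂) =
  contradiction (trans (sym e) e₂) (ψ∘≢ψ• (index∈ s₂))
splitting-deco-unique {α = •} {β = ∘} s@(_ , _ , _ , e) s₂@(_ , _ , _ , e₂) =
  contradiction (trans (sym e₂) e) (ψ∘≢ψ• (index∈ s))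

splitting-unique : ∀ {w u v′ i α u₂ v₂ j β} → Splitting w u v′ i α → Splitting w u₂ v₂ j β →
  length u ≡ length u₂ → u ≡ u₂ × v′ ≡ v₂ × i ≡ j × α ≡ β
splitting-unique {w} {u} {v′} {i} {α} {u₂} {v₂} {j} s@(_ , _ , _ , e) s₂@(_ , _ , _ , e₂) len
  with splitting-deco-unique s s₂
... | refl with trans (sym (unfactor-splitting u v′ i α e))
                 (trans (cong (λ k → unfactor α k w) len) (unfactor-splitting u₂ v₂ j α e₂))
...   | refl = refl , refl , refl , refl

packed? : ∀ w → Dec (IsPacked w)
packed? w = All.all? (1 ≤?_) w ×-dec map′ cover uncover (allUpTo? (λ n → suc n ∈? w) (maxW w))
  where
  cover : (∀ {n} → n < maxW w → suc n ∈ w) → ∀ k → 1 ≤ k → k ≤ maxW w → k ∈ w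
  cover h (suc k) _ k<max = h k<max
  uncover : (∀ k → 1 ≤ k → k ≤ maxW w → k ∈ w) → ∀ {n} → n < maxW w → suc n ∈ w
  uncover h n<max = h _ (s≤s z≤n) n<max

validIdx? : ∀ i α x → Dec (ValidIdx i α x)
validIdx? i ∘ x = 1 ≤? i ×-dec i ≤? suc (maxW x)
validIdx? i • x = 1 ≤? i ×-dec i ≤? maxW x

splitting? : ∀ w u v′ i α → Dec (Splitting w u v′ i α)
splitting? w u v′ i α =
  packed? u ×-dec packed? v′ ×-dec validIdx? i α v′ ×-dec ≡-dec _≟_ w (ψ (i + maxW u) α (v′ ⊙ u))

SplitsAt : Word → ℕ → Set
SplitsAt w k = Σ Word λ u → Σ Word λ v′ → Σ ℕ λ i → Σ Deco λ α → Splitting w u v′ i α × length u ≡ k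

SplitsAs : Word → ℕ → Deco → Word × Word × ℕ → Set
SplitsAs w k α (u , v′ , i) = Splitting w u v′ i α × length u ≡ k

splitsAs? : ∀ w k α t → Dec (SplitsAs w k α t)
splitsAs? w k α (u , v′ , i) = splitting? w u v′ i α ×-dec length u ≟ k

splitsAt? : ∀ w → Decidable (SplitsAt w)
splitsAt? w k = map′ sound complete (splitsAs? w k ∘ (unfactor ∘ k w) ⊎-dec splitsAs? w k • (unfactor • k w))
  where
  Candidate : Deco → Set
  Candidate α = SplitsAs w k α (unfactor α k w)
  found : ∀ α t → SplitsAs w k α t → SplitsAt w k
  found α (u , v′ , i) (s , len) = u , v′ , i , α , s , len
  sound : Candidate ∘ ⊎ Candidate • → SplitsAt w k
  sound (inj₁ c) = found ∘ (unfactor ∘ k w) c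
  sound (inj₂ c) = found • (unfactor • k w) c
  candidate : ∀ u v′ i α → Splitting w u v′ i α → length u ≡ k → Candidate α
  candidate u v′ i α s@(_ , _ , _ , e) refl = subst (SplitsAs w k α) (sym (unfactor-splitting u v′ i α e)) (s , refl)
  complete : SplitsAt w k → Candidate ∘ ⊎ Candidate •
  complete (u , v′ , i , ∘ , s , len) = inj₁ (candidate u v′ i ∘ s len)
  complete (u , v′ , i , • , s , len) = inj₂ (candidate u v′ i • s len)

largestUpTo : ∀ {P : ℕ → Set} → Decidable P → ∀ n → (∀ {k} → P k → k ≤ n) → ∃ P →
  ∃ λ k → P k × (∀ {k′} → P k′ → k′ ≤ k)
largestUpTo P? n bound witness with P? n
... | yes Pn = n , Pn , bound
largestUpTo {P} P? zero    bound (k , Pk) | no ¬P0 = contradiction (subst P (n≤0⇒n≡0 (bound Pk)) Pk) ¬P0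
largestUpTo     P? (suc n) bound witness  | no ¬Pn = largestUpTo P? n below witness
  where
  below : ∀ {k} → _ → k ≤ n
  below Pk = ≤-pred (≤∧≢⇒< (bound Pk) λ { refl → ¬Pn Pk })

Maximal : Word → Word → Set
Maximal w u = ∀ {u₂ v₂ j β} → Splitting w u₂ v₂ j β → length u₂ ≤ length u

longest-splitting : ∀ {w} → IsPacked w → w ≢ [] →
  Σ Word λ u → Σ Word λ v′ → Σ ℕ λ i → Σ Deco λ α → Splitting w u v′ i α × Maximal w u
longest-splitting {w} pw w≢[] with decomposition pw w≢[]
... | v′ , i , α , d with largestUpTo (splitsAt? w) (length w) bounded (0 , [] , v′ , i , α , trivial-splitting d , refl)
  where
  bounded : ∀ {k} → SplitsAt w k → k ≤ length w
  bounded (_ , _ , _ , _ , s , refl) = splitting-length s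
...   | _ , (u , v₂ , j , β , s , refl) , largest = u , v₂ , j , β , s , λ s₂ → largest (_ , _ , _ , _ , s₂ , refl)

maximal⇒index≤ : ∀ {w u a b i α} → Splitting w u (a ++ b) i α → Maximal w u →
  All (maxW b <_) a → b ≢ [] → i ≤ maxW b
maximal⇒index≤ {u = u} {b = b} {i} s maximal above b≢[] with i ≤? maxW b
... | yes i≤mb = i≤mb
... | no  i≰mb = contradiction (maximal (regroup s above (≰⇒> i≰mb))) (<⇒≱ (⊙-longer u b≢[]))

maximal⇒irreducible : ∀ {w u v′ i α} → Irreducible w → Splitting w u v′ i α → Maximal w u →
  v′ ≢ [] → Irreducible v′
maximal⇒irreducible {w} {u} {v′} {i} {α} (_ , w-irreducible) s maximal v′≢[] =
  v′≢[] , λ { (c , descent) → w-irreducible (split c descent) }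
  where
  split : ∀ c → IsGlobalDescent v′ c → ∃ (IsGlobalDescent w)
  split c (1≤c , c<n , desc) =
    splitting-globalDescent s′ (take-≢[] 1≤c c<n) above (maximal⇒index≤ s′ maximal above b≢[])
    where
    b≢[] : drop c v′ ≢ []
    b≢[] = drop-≢[] c<n
    s′ : Splitting w u (take c v′ ++ drop c v′) i α
    s′ = subst (λ x → Splitting w u x i α) (sym (take++drop≡id c v′)) s
    above : All (maxW (drop c v′) <_) (take c v′)
    above = All.tabulate λ x∈ → desc _ _ x∈ (maxW-∈ b≢[])

maximal-shape : ∀ {w u v′ i α} → Irreducible w → Splitting w u v′ i α → Maximal w u →
  (v′ ≡ [] × i ≡ 1 × α ≡ ∘) ⊎ (Irreducible v′ × 1 ≤ i × i ≤ maxW v′)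
maximal-shape {v′ = []} {α = ∘} _ (_ , _ , (1≤i , i≤1) , _) _ = inj₁ (refl , ≤-antisym i≤1 1≤i , refl)
maximal-shape {v′ = []} {α = •} _ (_ , _ , (1≤i , i≤0) , _) _ = contradiction i≤0 (<⇒≱ 1≤i)
maximal-shape {v′ = v′@(_ ∷ _)} {α = α} irreducible s@(_ , _ , valid , _) maximal =
  inj₂ (maximal⇒irreducible irreducible s maximal (λ ()) , 1≤index α valid , maximal⇒index≤ {a = []} s maximal [] (λ ()))
  where
  1≤index : ∀ {i} α → ValidIdx i α v′ → 1 ≤ i
  1≤index ∘ (1≤i , _) = 1≤i
  1≤index • (1≤i , _) = 1≤i

mainTheorem12 : (w : Word) → IsPacked w → Irreducible w →
    Σ Word λ u → Σ Word λ v →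
      IsFactorization w u v ×
      (∀ u′ v′ → IsFactorization w u′ v′ →
        length u′ ≤ length u × (length u′ ≡ length u → u′ ≡ u × v′ ≡ v)) ×
      (∀ v′ i α → IsDecomp v i α v′ →
        (v′ ≡ [] × i ≡ 1 × α ≡ ∘) ⊎ (Irreducible v′ × 1 ≤ i × i ≤ maxW v′))
mainTheorem12 w pw irreducible with longest-splitting pw (proj₁ irreducible)
... | u , v′ , i , α , s@(_ , pv′ , valid , _) , maximal =
  u , ψ i α v′ , splitting⇒factorization s , longest , shape
  where
  longest : ∀ u₂ v₂ → IsFactorization w u₂ v₂ →
    length u₂ ≤ length u × (length u₂ ≡ length u → u₂ ≡ u × v₂ ≡ ψ i α v′)
  longest u₂ v₂ f with factorization⇒splitting f
  ... | _ , _ , _ , s₂ , v₂≡ = maximal s₂ , λ len → unique (splitting-unique s₂ s len) v₂≡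
    where
    unique : ∀ {v₂′ j β} → u₂ ≡ u × v₂′ ≡ v′ × j ≡ i × β ≡ α → v₂ ≡ ψ j β v₂′ → u₂ ≡ u × v₂ ≡ ψ i α v′
    unique (refl , refl , refl , refl) v₂≡ = refl , v₂≡
  shape : ∀ v₂′ j β → IsDecomp (ψ i α v′) j β v₂′ →
    (v₂′ ≡ [] × j ≡ 1 × β ≡ ∘) ⊎ (Irreducible v₂′ × 1 ≤ j × j ≤ maxW v₂′)
  shape v₂′ j β d with decomposition-unique (pv′ , valid , refl) d
  ... | refl , refl , refl = maximal-shape irreducible s maximal
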